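{- Let $F$ be a graph with $m$ edges, and let $G$ be a graph with $N$ vertices and average degree $d$ satisfying $$d \leq \sqrt{\frac{N^2 - 2N\cdot|V(F)|}{48m}}.$$ Then the complement $\overline{G}$ contains a copy of $F$.
   Context: $\overline{G}$ denotes the complement of the graph $G$. -}

module Defs where

open import Data.Nat using (ℕ; zero; suc; _+_; _*_; _<ᵇ_; NonZero)
open import Data.Bool using (Bool; true; false; not; _∧_; if_then_else_)
open import Data.Fin using (Fin; toℕ; _≟_)
open import Data.Nat.ListAction using (sum)
open import Data.List using (List; map; allFin; filter; length; concatMap)
open import Data.Product using (_×_; _,_; Σ)
open import Relation.Nullary.Decidable using (⌊_⌋)
open import Relation.Binary.PropositionalEquality using (_≡_)
open import Function.Definitions using (Injective)
open import Data.Integer using (+_)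
open import Data.Rational using (ℚ; _/_; _*_; _-_; _≤_; 0ℚ)
open import Data.Rational as ℚ using ()

record Graph (n : ℕ) : Set where
  field
    adj    : Fin n → Fin n → Bool
    symm   : ∀ i j → adj i j ≡ adj j i
    irrefl : ∀ i → adj i i ≡ false
open Graph public

∣V∣ : ∀ {n} → Graph n → ℕ
∣V∣ {n} _ = n

∣E∣ : ∀ {n} → Graph n → ℕ
∣E∣ {n} G = length (filter (λ p → Data.Bool._≟_ (adj G (Data.Product.proj₁ p) (Data.Product.proj₂ p) ∧ (toℕ (Data.Product.proj₁ p) <ᵇ toℕ (Data.Product.proj₂ p))) true)
  (concatMap (λ i → map (λ j → (i , j)) (allFin n)) (allFin n)))

degree : ∀ {n} → Graph n → Fin n → ℕ
degree {n} G i = length (filter (λ j → Data.Bool._≟_ (adj G i j) true) (allFin n))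

averageDegree : ∀ {n} → .{{NonZero n}} → Graph n → ℚ
averageDegree {n} G = (+ sum (map (degree G) (allFin n))) / n

complement : ∀ {n} → Graph n → Graph n
complement {n} G = record
  { adj = λ i j → not (adj G i j) ∧ not ⌊ i ≟ j ⌋
  ; symm = symm'
  ; irrefl = irr }
  where
  open import Relation.Binary.PropositionalEquality using (refl; cong₂; sym)
  open import Relation.Nullary using (yes; no)
  symm' : ∀ i j → (not (adj G i j) ∧ not ⌊ i ≟ j ⌋) ≡ (not (adj G j i) ∧ not ⌊ j ≟ i ⌋)
  symm' i j with i ≟ j | j ≟ i
  ... | yes _ | yes _ = cong₂ _∧_ (Relation.Binary.PropositionalEquality.cong not (symm G i j)) refl
  ... | no _  | no _  = cong₂ _∧_ (Relation.Binary.PropositionalEquality.cong not (symm G i j)) refl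
  ... | yes p | no q  = Data.Empty.⊥-elim (q (sym p))
    where import Data.Empty
  ... | no p  | yes q = Data.Empty.⊥-elim (p (sym q))
    where import Data.Empty
  irr : ∀ i → (not (adj G i i) ∧ not ⌊ i ≟ i ⌋) ≡ false
  irr i with i ≟ i
  ... | yes _ = Data.Bool.Properties.∧-zeroʳ _
    where import Data.Bool.Properties
  ... | no ¬p = Data.Empty.⊥-elim (¬p refl)
    where import Data.Empty

ContainsCopy : ∀ {k n} → Graph n → Graph k → Set
ContainsCopy {k} {n} H F =
  Σ (Fin k → Fin n) λ f → Injective _≡_ _≡_ f × (∀ i j → adj F i j ≡ true → adj H (f i) (f j) ≡ true)

ℕ→ℚ : ℕ → ℚ
ℕ→ℚ n = (+ n) / 1

-- Write S for the degree sum of G (so d = S/N), D ≤ 2m for that of F, a = N − 2|V(F)| and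
-- t = ⌊2S/N⌋. Call a vertex of G low if its degree is at most t; the h vertices that are not
-- low satisfy h(t+1) ≤ S < (t+1)N/2. Embed F into the low vertices of the complement greedily,
-- each time removing from F a vertex v of minimum degree: if j vertices remain besides v and v
-- has p neighbours among them, then p ≤ j and p(j+1) ≤ D, and the image of v must only avoid the
-- j used vertices and the at most tp G-neighbours of the images of those p neighbours. So a low
-- vertex is free once j + tp + h < N, and the hypothesis, cleared of denominators to
-- 24 D S² ≤ N³ a, gives this: directly if 2(t+1)(j+1) ≤ N, and through pN < 2(t+1)D otherwise.

module Submission where

open import Defs

module FinSums where
  open import Data.Nat
  open import Data.Nat.Properties
  open import Data.Fin using (Fin; zero; suc)
  open import Data.Product using (∃; _,_)
  open import Function using (_∘_)
  open import Relation.Nullary using (yes; no)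
  open import Relation.Binary.PropositionalEquality

  open import Algebra.Properties.Semiring.Sum +-*-semiring public
    using (sum; sum-syntax; ∑-distrib-+; ∑-comm; sum-remove; sum-cong-≗; *-distribˡ-sum)

  sum-const : ∀ n c → ∑[ i < n ] c ≡ n * c
  sum-const zero    c = refl
  sum-const (suc n) c = cong (c +_) (sum-const n c)

  sum-mono-≤ : ∀ {n} {f g : Fin n → ℕ} → (∀ i → f i ≤ g i) → sum f ≤ sum g
  sum-mono-≤ {zero}  f≤g = z≤n
  sum-mono-≤ {suc n} f≤g = +-mono-≤ (f≤g zero) (sum-mono-≤ (f≤g ∘ suc))

  ≤-sum : ∀ {n} (f : Fin n → ℕ) i → f i ≤ sum f
  ≤-sum f zero    = m≤m+n _ _
  ≤-sum f (suc i) = ≤-trans (≤-sum (f ∘ suc) i) (m≤n+m _ _)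

  sum≡0⇒≡0 : ∀ {n} (f : Fin n → ℕ) → sum f ≡ 0 → ∀ i → f i ≡ 0
  sum≡0⇒≡0 f sum≡0 i = n≤0⇒n≡0 (subst (f i ≤_) sum≡0 (≤-sum f i))

  sum-<⇒∃< : ∀ {n} (f g : Fin n → ℕ) → sum f < sum g → ∃ λ i → f i < g i
  sum-<⇒∃< {suc n} f g lt with f zero <? g zero
  ... | yes f₀<g₀ = zero , f₀<g₀
  ... | no  f₀≮g₀ with sum-<⇒∃< (f ∘ suc) (g ∘ suc)
                         (+-cancelˡ-< (g zero) _ _ (≤-<-trans (+-monoˡ-≤ _ (≮⇒≥ f₀≮g₀)) lt))
  ...   | i , fᵢ<gᵢ = suc i , fᵢ<gᵢ

module Counting where
  open import Data.Nat
  open import Data.Nat.Properties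
  open import Data.Bool using (Bool; true; false; _∧_; T)
  import Data.Bool as Bool
  open import Data.Fin as Fin using (Fin; toℕ)
  import Data.Fin.Properties as Finₚ
  open import Data.List using (List; []; _∷_; _++_; map; filter; length; allFin; concatMap; tabulate)
  import Data.List.Properties as List
  import Data.Nat.ListAction as List
  open import Data.Nat.ListAction.Properties using (sum-++)
  open import Data.Product using (_×_; _,_; proj₁; proj₂)
  open import Function using (_∘_; id)
  open import Relation.Binary using (tri<; tri≈; tri>)
  open import Relation.Binary.PropositionalEquality
  open FinSums

  χ : Bool → ℕ
  χ true  = 1
  χ false = 0

  χ≤1 : ∀ b → χ b ≤ 1
  χ≤1 true  = ≤-refl
  χ≤1 false = z≤n

  T⇒1≤χ : ∀ {b} → T b → 1 ≤ χ b
  T⇒1≤χ {true} _ = ≤-refl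

  length-filter : ∀ {A : Set} (b : A → Bool) (xs : List A) →
                  length (filter (λ x → b x Bool.≟ true) xs) ≡ List.sum (map (χ ∘ b) xs)
  length-filter b []       = refl
  length-filter b (x ∷ xs) with b x
  ... | true  = cong suc (length-filter b xs)
  ... | false = length-filter b xs

  sum-tabulate : ∀ {n} (f : Fin n → ℕ) → List.sum (tabulate f) ≡ sum f
  sum-tabulate {zero}  f = refl
  sum-tabulate {suc n} f = cong (f Fin.zero +_) (sum-tabulate (f ∘ Fin.suc))

  sum-allFin : ∀ {n} (f : Fin n → ℕ) → List.sum (map f (allFin n)) ≡ sum f
  sum-allFin f = trans (cong List.sum (List.map-tabulate id f)) (sum-tabulate f)

  sum-concatMap : ∀ {A B : Set} (h : B → ℕ) (g : A → List B) (xs : List A) →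
                  List.sum (map h (concatMap g xs)) ≡ List.sum (map (List.sum ∘ map h ∘ g) xs)
  sum-concatMap h g []       = refl
  sum-concatMap h g (x ∷ xs) = begin
    List.sum (map h (g x ++ concatMap g xs))
      ≡⟨ cong List.sum (List.map-++ h (g x) (concatMap g xs)) ⟩
    List.sum (map h (g x) ++ map h (concatMap g xs))
      ≡⟨ sum-++ (map h (g x)) _ ⟩
    List.sum (map h (g x)) + List.sum (map h (concatMap g xs))
      ≡⟨ cong (List.sum (map h (g x)) +_) (sum-concatMap h g xs) ⟩
    List.sum (map h (g x)) + List.sum (map (List.sum ∘ map h ∘ g) xs) ∎
    where open ≡-Reasoning

  module _ {n} (G : Graph n) where

    degree≡sum : ∀ i → degree G i ≡ ∑[ j < n ] χ (adj G i j)
    degree≡sum i = trans (length-filter (adj G i) (allFin n)) (sum-allFin (χ ∘ adj G i))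

    degreeSum≡sum : List.sum (map (degree G) (allFin n)) ≡ sum (degree G)
    degreeSum≡sum = sum-allFin (degree G)

    forwardEdge : Fin n → Fin n → ℕ
    forwardEdge i j = χ (adj G i j ∧ (toℕ i <ᵇ toℕ j))

    ∣E∣≡sum : ∣E∣ G ≡ ∑[ i < n ] ∑[ j < n ] forwardEdge i j
    ∣E∣≡sum = begin
      ∣E∣ G
        ≡⟨ length-filter b pairs ⟩
      List.sum (map (χ ∘ b) pairs)
        ≡⟨ sum-concatMap (χ ∘ b) row (allFin n) ⟩
      List.sum (map (List.sum ∘ map (χ ∘ b) ∘ row) (allFin n))
        ≡⟨ sum-allFin (List.sum ∘ map (χ ∘ b) ∘ row) ⟩
      ∑[ i < n ] List.sum (map (χ ∘ b) (row i))
        ≡⟨ sum-cong-≗ (λ i → trans (cong List.sum (sym (List.map-∘ (allFin n)))) (sum-allFin (forwardEdge i))) ⟩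
      ∑[ i < n ] ∑[ j < n ] forwardEdge i j ∎
      where
      open ≡-Reasoning
      b : Fin n × Fin n → Bool
      b p = adj G (proj₁ p) (proj₂ p) ∧ (toℕ (proj₁ p) <ᵇ toℕ (proj₂ p))
      row : Fin n → List (Fin n × Fin n)
      row i = map (i ,_) (allFin n)
      pairs : List (Fin n × Fin n)
      pairs = concatMap row (allFin n)

    adj≤forwardEdge : ∀ i j → χ (adj G i j) ≤ forwardEdge i j + forwardEdge j i
    adj≤forwardEdge i j with adj G i j in eq
    ... | false = z≤n
    ... | true rewrite symm G j i | eq with <-cmp (toℕ i) (toℕ j)
    ...   | tri< i<j _ _ = ≤-trans (T⇒1≤χ (<⇒<ᵇ i<j)) (m≤m+n _ _)
    ...   | tri> _ _ j<i = ≤-trans (T⇒1≤χ (<⇒<ᵇ j<i)) (m≤n+m _ _)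
    ...   | tri≈ _ i≡j _ with Finₚ.toℕ-injective i≡j
    ...     | refl with trans (sym eq) (irrefl G i)
    ...       | ()

    handshake : sum (degree G) ≤ 2 * ∣E∣ G
    handshake = begin
      ∑[ i < n ] degree G i
        ≡⟨ sum-cong-≗ degree≡sum ⟩
      ∑[ i < n ] ∑[ j < n ] χ (adj G i j)
        ≤⟨ sum-mono-≤ (λ i → sum-mono-≤ (adj≤forwardEdge i)) ⟩
      ∑[ i < n ] ∑[ j < n ] (forwardEdge i j + forwardEdge j i)
        ≡⟨ sum-cong-≗ (λ i → ∑-distrib-+ (forwardEdge i) (λ j → forwardEdge j i)) ⟩
      ∑[ i < n ] (∑[ j < n ] forwardEdge i j + ∑[ j < n ] forwardEdge j i)
        ≡⟨ ∑-distrib-+ (λ i → ∑[ j < n ] forwardEdge i j) (λ i → ∑[ j < n ] forwardEdge j i) ⟩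
      E + ∑[ i < n ] ∑[ j < n ] forwardEdge j i
        ≡⟨ cong (E +_) (∑-comm (λ i j → forwardEdge j i)) ⟩
      E + E
        ≡⟨ cong (E +_) (sym (+-identityʳ E)) ⟩
      2 * E
        ≡⟨ cong (2 *_) (sym ∣E∣≡sum) ⟩
      2 * ∣E∣ G ∎
      where
      open ≤-Reasoning
      E : ℕ
      E = ∑[ i < n ] ∑[ j < n ] forwardEdge i j

module GreedyEmbedding where
  open import Data.Nat hiding (_≟_)
  open import Data.Nat.Properties hiding (_≟_)
  open import Data.Bool using (Bool; true; false)
  open import Data.Fin using (Fin; zero; suc; punchIn; punchOut; _≟_)
  import Data.Fin.Properties as Fin
  open import Data.Vec.Functional using (insertAt)
  open import Data.Vec.Functional.Properties using (insertAt-lookup; insertAt-punchIn)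
  open import Data.Product using (∃; Σ; _×_; _,_)
  open import Data.Empty using (⊥-elim)
  open import Function using (_∘_)
  open import Function.Definitions using (Injective)
  open import Relation.Nullary using (Dec; yes; no; does)
  open import Relation.Nullary.Decidable using (dec-true; dec-false)
  open import Relation.Binary.PropositionalEquality
  open FinSums
  open Counting

  deleteVertex : ∀ {k} → Graph (suc k) → Fin (suc k) → Graph k
  deleteVertex F v = record
    { adj    = λ i j → adj F (punchIn v i) (punchIn v j)
    ; symm   = λ i j → symm F (punchIn v i) (punchIn v j)
    ; irrefl = λ i → irrefl F (punchIn v i)
    }

  module _ {k} (F : Graph (suc k)) (v : Fin (suc k)) where

    degree≡neighbours : degree F v ≡ ∑[ i < k ] χ (adj F v (punchIn v i))
    degree≡neighbours = begin
      degree F v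
        ≡⟨ degree≡sum F v ⟩
      ∑[ j < suc k ] χ (adj F v j)
        ≡⟨ sum-remove {i = v} (χ ∘ adj F v) ⟩
      χ (adj F v v) + ∑[ i < k ] χ (adj F v (punchIn v i))
        ≡⟨ cong (λ b → χ b + ∑[ i < k ] χ (adj F v (punchIn v i))) (irrefl F v) ⟩
      ∑[ i < k ] χ (adj F v (punchIn v i)) ∎
      where open ≡-Reasoning

    degreeSum-deleteVertex : sum (degree (deleteVertex F v)) ≤ sum (degree F)
    degreeSum-deleteVertex = begin
      ∑[ i < k ] degree (deleteVertex F v) i
        ≤⟨ sum-mono-≤ degree-punchIn ⟩
      ∑[ i < k ] degree F (punchIn v i)
        ≤⟨ m≤n+m _ _ ⟩
      degree F v + ∑[ i < k ] degree F (punchIn v i)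
        ≡⟨ sum-remove {i = v} (degree F) ⟨
      ∑[ i < suc k ] degree F i ∎
      where
      open ≤-Reasoning
      degree-punchIn : ∀ i → degree (deleteVertex F v) i ≤ degree F (punchIn v i)
      degree-punchIn i = begin
        degree (deleteVertex F v) i                                      ≡⟨ degree≡sum (deleteVertex F v) i ⟩
        ∑[ j < k ] χ (adj F (punchIn v i) (punchIn v j))                 ≤⟨ m≤n+m _ _ ⟩
        χ (adj F (punchIn v i) v) + ∑[ j < k ] χ (adj F (punchIn v i) (punchIn v j))
                                                                         ≡⟨ sum-remove {i = v} (χ ∘ adj F (punchIn v i)) ⟨
        ∑[ j < suc k ] χ (adj F (punchIn v i) j)                         ≡⟨ degree≡sum F (punchIn v i) ⟨
        degree F (punchIn v i)                                           ∎

  minimumVertex : ∀ {k} (f : Fin (suc k) → ℕ) → ∃ λ v → ∀ i → f v ≤ f i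
  minimumVertex {zero}  f = zero , λ { zero → ≤-refl }
  minimumVertex {suc k} f with minimumVertex (f ∘ suc)
  ... | v , v-min with f zero ≤? f (suc v)
  ...   | yes f₀≤ = zero  , λ { zero → ≤-refl ; (suc i) → ≤-trans f₀≤ (v-min i) }
  ...   | no  f₀≰ = suc v , λ { zero → <⇒≤ (≰⇒> f₀≰) ; (suc i) → v-min i }

  data Punched {k} (v : Fin (suc k)) : Fin (suc k) → Set where
    at      : Punched v v
    punched : ∀ i → Punched v (punchIn v i)

  punched? : ∀ {k} (v x : Fin (suc k)) → Punched v x
  punched? v x with v ≟ x
  ... | yes refl = at
  ... | no  v≢x  = subst (Punched v) (Fin.punchIn-punchOut v≢x) (punched (punchOut v≢x))

  complement-adj : ∀ {N} (G : Graph N) {x y} → adj G x y ≡ false → x ≢ y → adj (complement G) x y ≡ true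
  complement-adj G {x} {y} x≁y x≢y rewrite x≁y with x ≟ y
  ... | yes x≡y = ⊥-elim (x≢y x≡y)
  ... | no  _   = refl

  record LowEmbedding {N k} (G : Graph N) (t : ℕ) (F : Graph k) : Set where
    field
      embed     : Fin k → Fin N
      injective : Injective _≡_ _≡_ embed
      low       : ∀ i → degree G (embed i) ≤ t
      edges     : ∀ i j → adj F i j ≡ true → adj (complement G) (embed i) (embed j) ≡ true
  open LowEmbedding

  module _ {N k} {G : Graph N} {t} {F : Graph (suc k)} (v : Fin (suc k))
           (φ : LowEmbedding G t (deleteVertex F v))
           (w : Fin N) (w-low : degree G w ≤ t) (w-fresh : ∀ i → embed φ i ≢ w)
           (w-nonadjacent : ∀ i → adj F v (punchIn v i) ≡ true → adj G (embed φ i) w ≡ false) where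

    private
      f : Fin (suc k) → Fin N
      f = insertAt (embed φ) v w

      f-at : f v ≡ w
      f-at = insertAt-lookup (embed φ) v w

      f-punched : ∀ i → f (punchIn v i) ≡ embed φ i
      f-punched = insertAt-punchIn (embed φ) v w

      w-complement : ∀ i → adj F v (punchIn v i) ≡ true → adj (complement G) w (embed φ i) ≡ true
      w-complement i v~i = complement-adj G (trans (symm G w _) (w-nonadjacent i v~i)) (w-fresh i ∘ sym)

      f-injective : Injective _≡_ _≡_ f
      f-injective {x} {y} fx≡fy with punched? v x | punched? v y
      ... | at        | at        = refl
      ... | at        | punched j = ⊥-elim (w-fresh j (sym (trans (sym f-at) (trans fx≡fy (f-punched j)))))
      ... | punched i | at        = ⊥-elim (w-fresh i (trans (sym (f-punched i)) (trans fx≡fy f-at)))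
      ... | punched i | punched j =
        cong (punchIn v) (injective φ (trans (sym (f-punched i)) (trans fx≡fy (f-punched j))))

      f-low : ∀ x → degree G (f x) ≤ t
      f-low x with punched? v x
      ... | at        rewrite f-at        = w-low
      ... | punched i rewrite f-punched i = low φ i

      f-edges : ∀ x y → adj F x y ≡ true → adj (complement G) (f x) (f y) ≡ true
      f-edges x y x~y with punched? v x | punched? v y
      ... | at        | at        with trans (sym x~y) (irrefl F v)
      ...   | ()
      f-edges x y x~y | at | punched j rewrite f-at | f-punched j = w-complement j x~y
      f-edges x y x~y | punched i | at rewrite f-at | f-punched i =
        trans (symm (complement G) _ w) (w-complement i (trans (symm F v _) x~y))
      f-edges x y x~y | punched i | punched j rewrite f-punched i | f-punched j = edges φ i j x~y

    extend : LowEmbedding G t F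
    extend = record { embed = f ; injective = f-injective ; low = f-low ; edges = f-edges }

  isLow : ∀ {N} → Graph N → ℕ → Fin N → Bool
  isLow G t w = does (degree G w ≤? t)

  lowCount : ∀ {N} → Graph N → ℕ → ℕ
  lowCount {N} G t = ∑[ w < N ] χ (isLow G t w)

  χ-does : ∀ {A : Set} (A? : Dec A) → 1 ≤ χ (does A?) → A
  χ-does (yes a) _ = a

  χ≡0⇒≡false : ∀ {b} → χ b ≡ 0 → b ≡ false
  χ≡0⇒≡false {false} _ = refl

  sum-χ-≟ : ∀ {N} (x : Fin N) → ∑[ w < N ] χ (does (x ≟ w)) ≡ 1
  sum-χ-≟ {suc N} x = begin
    ∑[ w < suc N ] χ (does (x ≟ w))
      ≡⟨ sum-remove {i = x} (λ w → χ (does (x ≟ w))) ⟩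
    χ (does (x ≟ x)) + ∑[ w < N ] χ (does (x ≟ punchIn x w))
      ≡⟨ cong₂ _+_ (cong χ (dec-true (x ≟ x) refl))
                   (sum-cong-≗ λ w → cong χ (dec-false (x ≟ _) (Fin.punchInᵢ≢i x w ∘ sym))) ⟩
    1 + ∑[ w < N ] 0
      ≡⟨ cong suc (trans (sum-const N 0) (*-zeroʳ N)) ⟩
    1 ∎
    where open ≡-Reasoning

  module _ {N k} (G : Graph N) (t : ℕ) (f : Fin k → Fin N) (a : Fin k → Bool) where

    blocked : Fin N → ℕ
    blocked w = ∑[ i < k ] (χ (does (f i ≟ w)) + χ (a i) * χ (adj G (f i) w))

    sum-blocked : (∀ i → degree G (f i) ≤ t) → sum blocked ≤ k + t * ∑[ i < k ] χ (a i)
    sum-blocked f-low = begin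
      ∑[ w < N ] ∑[ i < k ] (χ (does (f i ≟ w)) + χ (a i) * χ (adj G (f i) w))
        ≡⟨ ∑-comm (λ w i → χ (does (f i ≟ w)) + χ (a i) * χ (adj G (f i) w)) ⟩
      ∑[ i < k ] ∑[ w < N ] (χ (does (f i ≟ w)) + χ (a i) * χ (adj G (f i) w))
        ≡⟨ sum-cong-≗ (λ i → ∑-distrib-+ (λ w → χ (does (f i ≟ w))) (λ w → χ (a i) * χ (adj G (f i) w))) ⟩
      ∑[ i < k ] (∑[ w < N ] χ (does (f i ≟ w)) + ∑[ w < N ] (χ (a i) * χ (adj G (f i) w)))
        ≡⟨ sum-cong-≗ (λ i → cong₂ _+_ (sum-χ-≟ (f i)) (neighbours-of i)) ⟩
      ∑[ i < k ] (1 + χ (a i) * degree G (f i))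
        ≤⟨ sum-mono-≤ (λ i → +-monoʳ-≤ 1 (≤-trans (*-monoʳ-≤ (χ (a i)) (f-low i)) (≤-reflexive (*-comm _ t)))) ⟩
      ∑[ i < k ] (1 + t * χ (a i))
        ≡⟨ ∑-distrib-+ (λ _ → 1) (λ i → t * χ (a i)) ⟩
      ∑[ i < k ] 1 + ∑[ i < k ] (t * χ (a i))
        ≡⟨ cong₂ _+_ (trans (sum-const k 1) (*-identityʳ k)) (sym (*-distribˡ-sum t (χ ∘ a))) ⟩
      k + t * ∑[ i < k ] χ (a i) ∎
      where
      open ≤-Reasoning
      neighbours-of : ∀ i → ∑[ w < N ] (χ (a i) * χ (adj G (f i) w)) ≡ χ (a i) * degree G (f i)
      neighbours-of i = sym (trans (cong (χ (a i) *_) (degree≡sum G (f i)))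
                                   (*-distribˡ-sum (χ (a i)) (χ ∘ adj G (f i))))

    free-vertex : (∀ i → degree G (f i) ≤ t) → k + t * ∑[ i < k ] χ (a i) < lowCount G t →
                  Σ (Fin N) λ w → degree G w ≤ t × (∀ i → f i ≢ w) × (∀ i → a i ≡ true → adj G (f i) w ≡ false)
    free-vertex f-low room with sum-<⇒∃< blocked (χ ∘ isLow G t) (≤-<-trans (sum-blocked f-low) room)
    ... | w , blocked<low = w , χ-does (degree G w ≤? t) (≤-trans (s≤s z≤n) blocked<low) , fresh , nonadjacent
      where
      unblocked : ∀ i → χ (does (f i ≟ w)) + χ (a i) * χ (adj G (f i) w) ≡ 0
      unblocked = sum≡0⇒≡0 _ (n<1⇒n≡0 (<-≤-trans blocked<low (χ≤1 (isLow G t w))))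
      fresh : ∀ i → f i ≢ w
      fresh i fi≡w with trans (sym (cong χ (dec-true (f i ≟ w) fi≡w))) (m+n≡0⇒m≡0 _ (unblocked i))
      ... | ()
      nonadjacent : ∀ i → a i ≡ true → adj G (f i) w ≡ false
      nonadjacent i aᵢ = χ≡0⇒≡false (trans (sym (*-identityˡ _))
        (subst (λ b → χ b * χ (adj G (f i) w) ≡ 0) aᵢ (m+n≡0⇒n≡0 (χ (does (f i ≟ w))) (unblocked i))))

  GreedyBudget : ∀ {N} → Graph N → (t D k : ℕ) → Set
  GreedyBudget G t D k = ∀ {j p} → j < k → p ≤ j → p * suc j ≤ D → j + t * p < lowCount G t

  greedy : ∀ {N} (G : Graph N) (t D : ℕ) {k} (F : Graph k) →
           sum (degree F) ≤ D → GreedyBudget G t D k → LowEmbedding G t F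
  greedy G t D {zero} F _ _ = record { embed = λ () ; injective = λ { {()} } ; low = λ () ; edges = λ () }
  greedy G t D {suc k} F ΣF≤D budget with minimumVertex (degree F)
  ... | v , v-min =
    let w , w-low , w-fresh , w-nonadjacent = free-vertex G t (embed φ) a (low φ) (budget ≤-refl p≤k p[1+k]≤D)
    in  extend v φ w w-low w-fresh w-nonadjacent
    where
    φ : LowEmbedding G t (deleteVertex F v)
    φ = greedy G t D (deleteVertex F v) (≤-trans (degreeSum-deleteVertex F v) ΣF≤D) (budget ∘ m<n⇒m<1+n)
    a : Fin k → Bool
    a i = adj F v (punchIn v i)
    p : ℕ
    p = ∑[ i < k ] χ (a i)
    p≤k : p ≤ k
    p≤k = ≤-trans (sum-mono-≤ (χ≤1 ∘ a)) (≤-reflexive (trans (sum-const k 1) (*-identityʳ k)))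
    p[1+k]≤D : p * suc k ≤ D
    p[1+k]≤D = begin
      p * suc k                      ≡⟨ *-comm p (suc k) ⟩
      suc k * p                      ≡⟨ cong (suc k *_) (degree≡neighbours F v) ⟨
      suc k * degree F v             ≡⟨ sum-const (suc k) (degree F v) ⟨
      ∑[ i < suc k ] degree F v      ≤⟨ sum-mono-≤ v-min ⟩
      sum (degree F)                 ≤⟨ ΣF≤D ⟩
      D                              ∎
      where open ≤-Reasoning

module Arithmetic where
  open import Data.Nat
  open import Data.Nat.Properties
  open import Data.Nat.Tactic.RingSolver
  open import Data.List using (_∷_; [])
  open import Data.Product using (_,_)
  open import Relation.Nullary using (yes; no)
  open import Relation.Nullary.Negation using (contradiction)
  open import Relation.Binary.PropositionalEquality

  square-mono-≤ : ∀ {m n} → m ≤ n → m * m ≤ n * n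
  square-mono-≤ m≤n = *-mono-≤ m≤n m≤n

  core-inequality : ∀ t N S E a → t * N ≤ 2 * S → suc t * N ≡ 2 * S + E → a ≤ N →
                    suc t * suc t * t * (N * N) * a ≤ 6 * (S * S) * (suc t * a + E)
  core-inequality zero N S E a _ _ _ = z≤n
  -- Here 2(t+1) ≤ 3t fails, so the slack E = 2N − 2S is needed when S is small compared to N.
  core-inequality 1 N S E a N≤2S 2N≡2S+E a≤N with 2 * (N * N) ≤? 5 * (S * S)
  ... | yes N²≲S² = *-cancelˡ-≤ 5 (begin
    5 * (2 * 2 * 1 * (N * N) * a)          ≡⟨ solve (N ∷ a ∷ []) ⟩
    10 * (2 * (N * N)) * a                 ≤⟨ *-monoˡ-≤ a (*-monoʳ-≤ 10 N²≲S²) ⟩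
    10 * (5 * (S * S)) * a                 ≡⟨ solve (S ∷ a ∷ []) ⟩
    50 * (S * S) * a                       ≤⟨ *-monoˡ-≤ a (*-monoˡ-≤ (S * S) (m≤m+n 50 10)) ⟩
    60 * (S * S) * a                       ≤⟨ m≤m+n _ (30 * (S * S) * E) ⟩
    60 * (S * S) * a + 30 * (S * S) * E    ≡⟨ solve (S ∷ a ∷ E ∷ []) ⟩
    5 * (6 * (S * S) * (2 * a + E))        ∎)
    where open ≤-Reasoning
  ... | no  N²≴S² = begin
    2 * 2 * 1 * (N * N) * a                ≡⟨ solve (N ∷ a ∷ []) ⟩
    4 * a * (N * N)                        ≤⟨ *-monoʳ-≤ (4 * a) (square-mono-≤ (subst (_≤ 2 * S) (*-identityˡ N) N≤2S)) ⟩
    4 * a * ((2 * S) * (2 * S))            ≡⟨ solve (S ∷ a ∷ []) ⟩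
    12 * (S * S) * a + 2 * (S * S) * (2 * a) ≤⟨ +-monoʳ-≤ (12 * (S * S) * a) (*-monoʳ-≤ (2 * (S * S)) 2a≤3E) ⟩
    12 * (S * S) * a + 2 * (S * S) * (3 * E) ≡⟨ solve (S ∷ a ∷ E ∷ []) ⟩
    6 * (S * S) * (2 * a + E)              ∎
    where
    open ≤-Reasoning
    3S<2N : 3 * S < 2 * N
    3S<2N with 2 * N ≤? 3 * S
    ... | no  2N≰3S = ≰⇒> 2N≰3S
    ... | yes 2N≤3S = contradiction (begin-strict
      20 * (N * N)                ≡⟨ solve (N ∷ []) ⟩
      5 * ((2 * N) * (2 * N))     ≤⟨ *-monoʳ-≤ 5 (square-mono-≤ 2N≤3S) ⟩
      5 * ((3 * S) * (3 * S))     ≡⟨ solve (S ∷ []) ⟩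
      9 * (5 * (S * S))           <⟨ *-monoʳ-< 9 (≰⇒> N²≴S²) ⟩
      9 * (2 * (N * N))           ≡⟨ solve (N ∷ []) ⟩
      18 * (N * N)                ∎) (≤⇒≯ (*-monoˡ-≤ (N * N) (m≤m+n 18 2)))
    2a≤3E : 2 * a ≤ 3 * E
    2a≤3E = ≤-trans (*-monoʳ-≤ 2 a≤N) (<⇒≤ (+-cancelʳ-< (6 * S) (2 * N) (3 * E) (begin-strict
      2 * N + 6 * S               ≡⟨ solve (N ∷ S ∷ []) ⟩
      2 * N + 2 * (3 * S)         <⟨ +-monoʳ-< (2 * N) (*-monoʳ-< 2 3S<2N) ⟩
      2 * N + 2 * (2 * N)         ≡⟨ solve (N ∷ []) ⟩
      3 * (2 * N)                 ≡⟨ cong (3 *_) 2N≡2S+E ⟩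
      3 * (2 * S + E)             ≡⟨ solve (S ∷ E ∷ []) ⟩
      3 * E + 6 * S               ∎)))
  core-inequality (suc (suc t)) N S E a uN≤2S _ _ = ≤-trans (*-cancelˡ-≤ 2 (begin
    2 * ((3 + t) * (3 + t) * (2 + t) * (N * N) * a)      ≡⟨ solve (t ∷ N ∷ a ∷ []) ⟩
    (2 * (3 + t)) * ((3 + t) * (2 + t) * (N * N) * a)    ≤⟨ *-monoˡ-≤ ((3 + t) * (2 + t) * (N * N) * a) 2T≤3u ⟩
    (3 * (2 + t)) * ((3 + t) * (2 + t) * (N * N) * a)    ≡⟨ solve (t ∷ N ∷ a ∷ []) ⟩
    3 * (3 + t) * a * (((2 + t) * N) * ((2 + t) * N))    ≤⟨ *-monoʳ-≤ (3 * (3 + t) * a) (square-mono-≤ uN≤2S) ⟩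
    3 * (3 + t) * a * ((2 * S) * (2 * S))                ≡⟨ solve (t ∷ S ∷ a ∷ []) ⟩
    2 * (6 * (S * S) * ((3 + t) * a))                    ∎)) (*-monoʳ-≤ (6 * (S * S)) (m≤m+n ((3 + t) * a) E))
    where
    open ≤-Reasoning
    2T≤3u : 2 * (3 + t) ≤ 3 * (2 + t)
    2T≤3u = begin
      2 * (3 + t)  ≡⟨ solve (t ∷ []) ⟩
      6 + 2 * t    ≤⟨ +-monoʳ-≤ 6 (*-monoˡ-≤ t (m≤m+n 2 1)) ⟩
      6 + 3 * t    ≡⟨ solve (t ∷ []) ⟩
      3 * (2 + t)  ∎

  density-inequality : ∀ t N S E a D .{{_ : NonZero N}} →
                       t * N ≤ 2 * S → suc t * N ≡ 2 * S + E → a ≤ N → 24 * D * (S * S) ≤ N * N * N * a →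
                       4 * (suc t * suc t * t * D) ≤ N * (suc t * a + E)
  density-inequality zero N S E a D _ _ _ _ = z≤n
  density-inequality (suc t) N S E a D tN≤2S tN≡2S+E a≤N 24DS²≤N³a =
    *-cancelˡ-≤ (6 * (S * S)) (begin
    6 * (S * S) * (4 * ((2 + t) * (2 + t) * (1 + t) * D))   ≡⟨ solve (t ∷ S ∷ D ∷ []) ⟩
    (2 + t) * (2 + t) * (1 + t) * (24 * D * (S * S))        ≤⟨ *-monoʳ-≤ ((2 + t) * (2 + t) * (1 + t)) 24DS²≤N³a ⟩
    (2 + t) * (2 + t) * (1 + t) * (N * N * N * a)           ≡⟨ solve (t ∷ N ∷ a ∷ []) ⟩
    N * ((2 + t) * (2 + t) * (1 + t) * (N * N) * a)         ≤⟨ *-monoʳ-≤ N core ⟩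
    N * (6 * (S * S) * ((2 + t) * a + E))                   ≡⟨ solve (t ∷ N ∷ S ∷ a ∷ E ∷ []) ⟩
    6 * (S * S) * (N * ((2 + t) * a + E))                   ∎)
    where
    open ≤-Reasoning
    core : (2 + t) * (2 + t) * (1 + t) * (N * N) * a ≤ 6 * (S * S) * ((2 + t) * a + E)
    core = core-inequality (suc t) N S E a tN≤2S tN≡2S+E a≤N
    instance
      S≢0 : NonZero S
      S≢0 = ≢-nonZero λ { refl → ≢-nonZero⁻¹ N (n≤0⇒n≡0 (≤-trans (m≤n*m N (suc t)) tN≤2S)) }
      6S²≢0 : NonZero (6 * (S * S))
      6S²≢0 = m*n≢0 6 (S * S) {{_}} {{m*n≢0 S S}}

  greedy-budget : ∀ {N k a t S h D j p} .{{_ : NonZero N}} → 2 * k + a ≡ N → 24 * D * (S * S) ≤ N * N * N * a →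
                  t * N ≤ 2 * S → 2 * S < suc t * N → h * suc t ≤ S →
                  j < k → p ≤ j → p * suc j ≤ D → j + t * p + h < N
  greedy-budget {N} {k} {a} {t} {S} {h} {D} {j} {p} 2k+a≡N 24DS²≤N³a tN≤2S 2S<TN hT≤S j<k p≤j p[1+j]≤D
    with 2 * suc t * suc j ≤? N
  ... | yes 2T[1+j]≤N = *-cancelˡ-< 2 (j + t * p + h) N (begin-strict
    2 * (j + t * p + h)       ≤⟨ *-monoʳ-≤ 2 (+-monoˡ-≤ h (+-monoʳ-≤ j (*-monoʳ-≤ t p≤j))) ⟩
    2 * (j + t * j + h)       ≡⟨ solve (j ∷ t ∷ h ∷ []) ⟩
    2 * (1 + t) * j + 2 * h   <⟨ +-mono-< 2Tj<N 2h<N ⟩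
    N + N                     ≡⟨ solve (N ∷ []) ⟩
    2 * N                     ∎)
    where
    open ≤-Reasoning
    2Tj<N : 2 * (1 + t) * j < N
    2Tj<N = begin-strict
      2 * (1 + t) * j                     <⟨ m<m+n _ (s≤s z≤n) ⟩
      2 * (1 + t) * j + 2 * (1 + t)       ≡⟨ solve (t ∷ j ∷ []) ⟩
      2 * (1 + t) * (1 + j)               ≤⟨ 2T[1+j]≤N ⟩
      N                                   ∎
    2h<N : 2 * h < N
    2h<N = *-cancelˡ-< (1 + t) (2 * h) N (begin-strict
      (1 + t) * (2 * h)   ≡⟨ solve (t ∷ h ∷ []) ⟩
      2 * (h * (1 + t))   ≤⟨ *-monoʳ-≤ 2 hT≤S ⟩
      2 * S               <⟨ 2S<TN ⟩
      (1 + t) * N         ∎)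
  ... | no 2T[1+j]≰N with m≤n⇒∃[o]m+o≡n (<⇒≤ 2S<TN)
  ...   | E , 2S+E≡TN = *-cancelˡ-≤ (2 * suc t * N) {{m*n≢0 (2 * suc t) N}} (begin
    2 * (1 + t) * N * suc (j + t * p + h)
      ≡⟨ solve (N ∷ t ∷ j ∷ p ∷ h ∷ []) ⟩
    2 * (1 + t) * N * (1 + j) + 2 * (1 + t) * t * (p * N) + 2 * N * (h * (1 + t))
      ≤⟨ +-mono-≤ (+-mono-≤ (*-monoʳ-≤ (2 * (1 + t) * N) j<k) (*-monoʳ-≤ (2 * (1 + t) * t) pN≤2TD))
                  (*-monoʳ-≤ (2 * N) hT≤S) ⟩
    2 * (1 + t) * N * k + 2 * (1 + t) * t * (2 * (1 + t) * D) + 2 * N * S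
      ≡⟨ solve (N ∷ t ∷ k ∷ D ∷ S ∷ []) ⟩
    2 * (1 + t) * N * k + 4 * ((1 + t) * (1 + t) * t * D) + 2 * N * S
      ≤⟨ +-monoˡ-≤ (2 * N * S) (+-monoʳ-≤ (2 * (1 + t) * N * k)
           (density-inequality t N S E a D tN≤2S (sym 2S+E≡TN) a≤N 24DS²≤N³a)) ⟩
    2 * (1 + t) * N * k + N * ((1 + t) * a + E) + 2 * N * S
      ≡⟨ solve (N ∷ t ∷ k ∷ a ∷ E ∷ S ∷ []) ⟩
    N * ((1 + t) * (2 * k + a) + (2 * S + E))
      ≡⟨ cong (λ x → N * ((1 + t) * x + (2 * S + E))) 2k+a≡N ⟩
    N * ((1 + t) * N + (2 * S + E))
      ≡⟨ cong (λ x → N * ((1 + t) * N + x)) 2S+E≡TN ⟩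
    N * ((1 + t) * N + (1 + t) * N)
      ≡⟨ solve (N ∷ t ∷ []) ⟩
    2 * (1 + t) * N * N ∎)
    where
    open ≤-Reasoning
    a≤N : a ≤ N
    a≤N = subst (a ≤_) 2k+a≡N (m≤n+m a (2 * k))
    pN≤2TD : p * N ≤ 2 * (1 + t) * D
    pN≤2TD = begin
      p * N                         ≤⟨ *-monoʳ-≤ p (<⇒≤ (≰⇒> 2T[1+j]≰N)) ⟩
      p * (2 * (1 + t) * (1 + j))   ≡⟨ solve (p ∷ t ∷ j ∷ []) ⟩
      2 * (1 + t) * (p * (1 + j))   ≤⟨ *-monoʳ-≤ (2 * (1 + t)) p[1+j]≤D ⟩
      2 * (1 + t) * D               ∎

module RationalHypotheses where
  open import Data.Nat as ℕ using (ℕ)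
  import Data.Nat.Properties as ℕ
  open import Data.Integer as ℤ using (+_)
  import Data.Integer.Properties as ℤ
  open import Data.Rational
  open import Data.Rational.Properties
  open import Data.Rational.Unnormalised as ℚᵘ using (ℚᵘ; mkℚᵘ; *≡*; *≤*)
  import Data.Rational.Unnormalised.Properties as ℚᵘ
  open import Relation.Binary.PropositionalEquality
  import Data.Rational.Solver

  ι : ℕ → ℚᵘ
  ι n = mkℚᵘ (+ n) 0

  toℚᵘ-ℕ→ℚ : ∀ n → toℚᵘ (ℕ→ℚ n) ℚᵘ.≃ ι n
  toℚᵘ-ℕ→ℚ n = toℚᵘ-fromℚᵘ (ι n)

  ℕ→ℚ-+ : ∀ m n → ℕ→ℚ (m ℕ.+ n) ≡ ℕ→ℚ m + ℕ→ℚ n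
  ℕ→ℚ-+ m n = toℚᵘ-injective (begin
    toℚᵘ (ℕ→ℚ (m ℕ.+ n))               ≈⟨ toℚᵘ-ℕ→ℚ (m ℕ.+ n) ⟩
    ι (m ℕ.+ n)                         ≈⟨ *≡* (cong (ℤ._* + 1) (trans (ℤ.pos-+ m n)
                                              (sym (cong₂ ℤ._+_ (ℤ.*-identityʳ (+ m)) (ℤ.*-identityʳ (+ n)))))) ⟩
    ι m ℚᵘ.+ ι n                        ≈⟨ ℚᵘ.+-cong (toℚᵘ-ℕ→ℚ m) (toℚᵘ-ℕ→ℚ n) ⟨
    toℚᵘ (ℕ→ℚ m) ℚᵘ.+ toℚᵘ (ℕ→ℚ n)      ≈⟨ toℚᵘ-homo-+ (ℕ→ℚ m) (ℕ→ℚ n) ⟨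
    toℚᵘ (ℕ→ℚ m + ℕ→ℚ n)               ∎)
    where open ℚᵘ.≃-Reasoning

  ℕ→ℚ-* : ∀ m n → ℕ→ℚ (m ℕ.* n) ≡ ℕ→ℚ m * ℕ→ℚ n
  ℕ→ℚ-* m n = toℚᵘ-injective (begin
    toℚᵘ (ℕ→ℚ (m ℕ.* n))               ≈⟨ toℚᵘ-ℕ→ℚ (m ℕ.* n) ⟩
    ι (m ℕ.* n)                         ≈⟨ *≡* (cong (ℤ._* + 1) (ℤ.pos-* m n)) ⟩
    ι m ℚᵘ.* ι n                        ≈⟨ ℚᵘ.*-cong (toℚᵘ-ℕ→ℚ m) (toℚᵘ-ℕ→ℚ n) ⟨
    toℚᵘ (ℕ→ℚ m) ℚᵘ.* toℚᵘ (ℕ→ℚ n)      ≈⟨ toℚᵘ-homo-* (ℕ→ℚ m) (ℕ→ℚ n) ⟨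
    toℚᵘ (ℕ→ℚ m * ℕ→ℚ n)               ∎)
    where open ℚᵘ.≃-Reasoning

  ℕ→ℚ-cancel-≤ : ∀ {m n} → ℕ→ℚ m ≤ ℕ→ℚ n → m ℕ.≤ n
  ℕ→ℚ-cancel-≤ {m} {n} m≤n
    with ℚᵘ.≤-respʳ-≃ (toℚᵘ-ℕ→ℚ n) (ℚᵘ.≤-respˡ-≃ (toℚᵘ-ℕ→ℚ m) (toℚᵘ-mono-≤ m≤n))
  ... | *≤* m*1≤n*1 = ℤ.drop‿+≤+ (subst₂ ℤ._≤_ (ℤ.*-identityʳ (+ m)) (ℤ.*-identityʳ (+ n)) m*1≤n*1)

  average*count : ∀ s n .{{_ : ℕ.NonZero n}} → (+ s / n) * ℕ→ℚ n ≡ ℕ→ℚ s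
  average*count s n@(ℕ.suc n-1) = toℚᵘ-injective (begin
    toℚᵘ ((+ s / n) * ℕ→ℚ n)
      ≈⟨ toℚᵘ-homo-* (+ s / n) (ℕ→ℚ n) ⟩
    toℚᵘ (+ s / n) ℚᵘ.* toℚᵘ (ℕ→ℚ n)
      ≈⟨ ℚᵘ.*-cong (toℚᵘ-fromℚᵘ (mkℚᵘ (+ s) n-1)) (toℚᵘ-ℕ→ℚ n) ⟩
    mkℚᵘ (+ s) n-1 ℚᵘ.* ι n
      ≈⟨ *≡* (trans (ℤ.*-identityʳ _) (cong (λ d → + s ℤ.* + d) (sym (ℕ.*-identityʳ n)))) ⟩
    ι s
      ≈⟨ toℚᵘ-ℕ→ℚ s ⟨
    toℚᵘ (ℕ→ℚ s) ∎)
    where open ℚᵘ.≃-Reasoning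

  open Data.Rational.Solver.+-*-Solver using (solve; _:+_; _:-_; _:*_; _:=_)

  0≤p-q⇒q≤p : ∀ p q → 0ℚ ≤ p - q → q ≤ p
  0≤p-q⇒q≤p p q 0≤p-q = begin
    q             ≡⟨ +-identityʳ q ⟨
    q + 0ℚ        ≤⟨ +-monoʳ-≤ q 0≤p-q ⟩
    q + (p - q)   ≡⟨ solve 2 (λ p q → q :+ (p :- q) := p) refl p q ⟩
    p             ∎
    where open ≤-Reasoning

  size-hypothesis : ∀ {N k} .{{_ : ℕ.NonZero N}} →
                     0ℚ ≤ ℕ→ℚ N * ℕ→ℚ N - ℕ→ℚ 2 * ℕ→ℚ N * ℕ→ℚ k → 2 ℕ.* k ℕ.≤ N
  size-hypothesis {N} {k} 0≤N²-2Nk = ℕ.*-cancelˡ-≤ N (ℕ→ℚ-cancel-≤ (begin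
    ℕ→ℚ (N ℕ.* (2 ℕ.* k))   ≡⟨ trans (ℕ→ℚ-* N (2 ℕ.* k)) (cong (N̂ *_) (ℕ→ℚ-* 2 k)) ⟩
    N̂ * (2̂ * k̂)             ≡⟨ solve 3 (λ N 2̂ k → N :* (2̂ :* k) := 2̂ :* N :* k) refl N̂ 2̂ k̂ ⟩
    2̂ * N̂ * k̂               ≤⟨ 0≤p-q⇒q≤p (N̂ * N̂) (2̂ * N̂ * k̂) 0≤N²-2Nk ⟩
    N̂ * N̂                   ≡⟨ ℕ→ℚ-* N N ⟨
    ℕ→ℚ (N ℕ.* N)           ∎))
    where
    open ≤-Reasoning
    N̂ : ℚ
    N̂ = ℕ→ℚ N
    k̂ : ℚ
    k̂ = ℕ→ℚ k
    2̂ : ℚ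
    2̂ = ℕ→ℚ 2

  density-hypothesis : ∀ {N k a m} s .{{_ : ℕ.NonZero N}} → 2 ℕ.* k ℕ.+ a ≡ N →
    (+ s / N) * (+ s / N) * (ℕ→ℚ 48 * ℕ→ℚ m) ≤ ℕ→ℚ N * ℕ→ℚ N - ℕ→ℚ 2 * ℕ→ℚ N * ℕ→ℚ k →
    s ℕ.* s ℕ.* (48 ℕ.* m) ℕ.≤ N ℕ.* N ℕ.* N ℕ.* a
  density-hypothesis {N} {k} {a} {m} s 2k+a≡N d²48m≤N²-2Nk = ℕ→ℚ-cancel-≤ (begin
    ℕ→ℚ (s ℕ.* s ℕ.* (48 ℕ.* m))
      ≡⟨ trans (ℕ→ℚ-* (s ℕ.* s) (48 ℕ.* m)) (cong₂ _*_ (ℕ→ℚ-* s s) (ℕ→ℚ-* 48 m)) ⟩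
    ŝ * ŝ * c
      ≡⟨ cong (λ x → x * x * c) (average*count s N) ⟨
    (d * N̂) * (d * N̂) * c
      ≡⟨ solve 3 (λ d N c → (d :* N) :* (d :* N) :* c := N :* N :* (d :* d :* c)) refl d N̂ c ⟩
    N̂ * N̂ * (d * d * c)
      ≤⟨ *-monoˡ-≤-nonNeg (N̂ * N̂) {{N̂²-nonNeg}} d²48m≤N²-2Nk ⟩
    N̂ * N̂ * (N̂ * N̂ - 2̂ * N̂ * k̂)
      ≡⟨ solve 3 (λ N 2̂ k → N :* N :* (N :* N :- 2̂ :* N :* k) := N :* N :* N :* (N :- 2̂ :* k)) refl N̂ 2̂ k̂ ⟩
    N̂ * N̂ * N̂ * (N̂ - 2̂ * k̂)
      ≡⟨ cong (N̂ * N̂ * N̂ *_) N̂-2̂k̂≡â ⟩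
    N̂ * N̂ * N̂ * â
      ≡⟨ trans (ℕ→ℚ-* (N ℕ.* N ℕ.* N) a) (cong (_* â) (trans (ℕ→ℚ-* (N ℕ.* N) N) (cong (_* N̂) (ℕ→ℚ-* N N)))) ⟨
    ℕ→ℚ (N ℕ.* N ℕ.* N ℕ.* a) ∎)
    where
    open ≤-Reasoning
    d : ℚ
    d = + s / N
    ŝ : ℚ
    ŝ = ℕ→ℚ s
    N̂ : ℚ
    N̂ = ℕ→ℚ N
    k̂ : ℚ
    k̂ = ℕ→ℚ k
    â : ℚ
    â = ℕ→ℚ a
    2̂ : ℚ
    2̂ = ℕ→ℚ 2
    c : ℚ
    c = ℕ→ℚ 48 * ℕ→ℚ m
    N̂²-nonNeg : NonNegative (N̂ * N̂)
    -- ℕ→ℚ N unfolds to normalize N 1.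
    N̂²-nonNeg = nonNeg*nonNeg⇒nonNeg N̂ {{normalize-nonNeg N 1}} N̂ {{normalize-nonNeg N 1}}
    N̂-2̂k̂≡â : N̂ - 2̂ * k̂ ≡ â
    N̂-2̂k̂≡â = begin-equality
      N̂ - 2̂ * k̂
        ≡⟨ cong (λ x → ℕ→ℚ x - 2̂ * k̂) 2k+a≡N ⟨
      ℕ→ℚ (2 ℕ.* k ℕ.+ a) - 2̂ * k̂
        ≡⟨ cong (_- 2̂ * k̂) (trans (ℕ→ℚ-+ (2 ℕ.* k) a) (cong (_+ â) (ℕ→ℚ-* 2 k))) ⟩
      2̂ * k̂ + â - 2̂ * k̂
        ≡⟨ solve 2 (λ x y → x :+ y :- x := y) refl (2̂ * k̂) â ⟩
      â ∎

module ComplementEmbedding where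
  open import Data.Nat
  open import Data.Nat.Properties
  open import Data.Nat.DivMod using (_/_; _%_; m/n*n≤m; m≡m%n+[m/n]*n; m%n<n)
  open import Data.Nat.Tactic.RingSolver
  open import Data.Bool using (true; false; not)
  open import Data.List using (_∷_; [])
  open import Data.Product using (_,_)
  open import Relation.Nullary using (Dec; yes; no; does)
  open import Relation.Binary.PropositionalEquality
  open FinSums
  open Counting
  open GreedyEmbedding
  open Arithmetic

  m<[1+m/n]*n : ∀ m n .{{_ : NonZero n}} → m < suc (m / n) * n
  m<[1+m/n]*n m n = begin-strict
    m                     ≡⟨ m≡m%n+[m/n]*n m n ⟩
    m % n + m / n * n     <⟨ +-monoˡ-< (m / n * n) (m%n<n m n) ⟩
    n + m / n * n         ∎
    where open ≤-Reasoning

  χ+χ-not : ∀ b → χ b + χ (not b) ≡ 1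
  χ+χ-not true  = refl
  χ+χ-not false = refl

  module _ {N} (G : Graph N) (t : ℕ) where

    highCount : ℕ
    highCount = ∑[ w < N ] χ (not (isLow G t w))

    lowCount+highCount : lowCount G t + highCount ≡ N
    lowCount+highCount = begin
      lowCount G t + highCount
        ≡⟨ ∑-distrib-+ (λ w → χ (isLow G t w)) (λ w → χ (not (isLow G t w))) ⟨
      ∑[ w < N ] (χ (isLow G t w) + χ (not (isLow G t w)))
        ≡⟨ sum-cong-≗ (λ w → χ+χ-not (isLow G t w)) ⟩
      ∑[ w < N ] 1
        ≡⟨ trans (sum-const N 1) (*-identityʳ N) ⟩
      N ∎
      where
      open ≡-Reasoning

    highCount-degrees : highCount * suc t ≤ sum (degree G)
    highCount-degrees = begin
      highCount * suc t                           ≡⟨ *-comm highCount (suc t) ⟩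
      suc t * highCount                           ≡⟨ *-distribˡ-sum (suc t) (λ w → χ (not (isLow G t w))) ⟩
      ∑[ w < N ] (suc t * χ (not (isLow G t w)))  ≤⟨ sum-mono-≤ high⇒degree ⟩
      ∑[ w < N ] degree G w                       ∎
      where
      open ≤-Reasoning
      high⇒degree : ∀ w → suc t * χ (not (isLow G t w)) ≤ degree G w
      high⇒degree w = above (degree G w ≤? t)
        where
        above : ∀ {d} (d≤?t : Dec (d ≤ t)) → suc t * χ (not (does d≤?t)) ≤ d
        above (yes _)   = ≤-trans (≤-reflexive (*-zeroʳ (suc t))) z≤n
        above (no  d≰t) = ≤-trans (≤-reflexive (*-identityʳ (suc t))) (≰⇒> d≰t)

  complement-contains : ∀ {k N a} .{{_ : NonZero N}} (F : Graph k) (G : Graph N) → 2 * k + a ≡ N →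
                        sum (degree G) * sum (degree G) * (48 * ∣E∣ F) ≤ N * N * N * a →
                        ContainsCopy (complement G) F
  complement-contains {k} {N} {a} F G 2k+a≡N S²48m≤N³a = embed φ , injective φ , edges φ
    where
    open LowEmbedding
    S : ℕ
    S = sum (degree G)
    D : ℕ
    D = sum (degree F)
    t : ℕ
    t = 2 * S / N
    24DS²≤N³a : 24 * D * (S * S) ≤ N * N * N * a
    24DS²≤N³a = begin
      24 * D * (S * S)                ≤⟨ *-monoˡ-≤ (S * S) (*-monoʳ-≤ 24 (handshake F)) ⟩
      24 * (2 * ∣E∣ F) * (S * S)      ≡⟨ reassociate (∣E∣ F) S ⟩
      S * S * (48 * ∣E∣ F)            ≤⟨ S²48m≤N³a ⟩
      N * N * N * a                   ∎
      where
      open ≤-Reasoning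
      reassociate : ∀ m S → 24 * (2 * m) * (S * S) ≡ S * S * (48 * m)
      reassociate m S = solve (m ∷ S ∷ [])
    budget : GreedyBudget G t D k
    budget {j} {p} j<k p≤j p[1+j]≤D =
      +-cancelʳ-< (highCount G t) (j + t * p) (lowCount G t)
        (subst (j + t * p + highCount G t <_) (sym (lowCount+highCount G t))
          (greedy-budget 2k+a≡N 24DS²≤N³a (m/n*n≤m (2 * S) N) (m<[1+m/n]*n (2 * S) N)
                         (highCount-degrees G t) j<k p≤j p[1+j]≤D))
    φ : LowEmbedding G t F
    φ = greedy G t D F ≤-refl budget

open import Data.Nat using (ℕ; NonZero)
open import Data.Rational using (_*_; _-_; _≤_; 0ℚ)
import Data.Nat as ℕ
import Data.Nat.ListAction as ListAction
import Data.List as List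
open import Data.Nat.Properties using (m≤n⇒∃[o]m+o≡n)
open import Data.Product using (_,_)
open import Relation.Binary.PropositionalEquality using (subst)
open Counting using (degreeSum≡sum)
open RationalHypotheses using (size-hypothesis; density-hypothesis)
open ComplementEmbedding using (complement-contains)

mainTheorem8 : ∀ {k N} → .{{_ : NonZero N}} → (F : Graph k) → (G : Graph N) →
    0ℚ ≤ (ℕ→ℚ N * ℕ→ℚ N - ℕ→ℚ 2 * ℕ→ℚ N * ℕ→ℚ (∣V∣ F)) →
    averageDegree G * averageDegree G * (ℕ→ℚ 48 * ℕ→ℚ (∣E∣ F)) ≤ (ℕ→ℚ N * ℕ→ℚ N - ℕ→ℚ 2 * ℕ→ℚ N * ℕ→ℚ (∣V∣ F)) →
    ContainsCopy (complement G) F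
mainTheorem8 {k} {N} F G 0≤N²-2Nk d²48m≤N²-2Nk =
  let a , 2k+a≡N = m≤n⇒∃[o]m+o≡n (size-hypothesis {N} {k} 0≤N²-2Nk)
      degreeSum = ListAction.sum (List.map (degree G) (List.allFin N))
  in  complement-contains F G 2k+a≡N
        (subst (λ S → S ℕ.* S ℕ.* (48 ℕ.* ∣E∣ F) ℕ.≤ N ℕ.* N ℕ.* N ℕ.* a) (degreeSum≡sum G)
               (density-hypothesis {N} {k} {a} {∣E∣ F} degreeSum 2k+a≡N d²48m≤N²-2Nk))
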